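{- Let $q$ be a prime power, $n\ge1$, and let $L:\mathbb{F}_{q^n}\to\mathbb{F}_{q^n}$ be an $\mathbb{F}_q$-linear mapping with kernel $\alpha\mathbb{F}_q$, where $\alpha\neq0$. Suppose $\alpha$ is a $b$-linear translator of $f:\mathbb{F}_{q^n}\to\mathbb{F}_q$, let $h:\mathbb{F}_q\to\mathbb{F}_q$ be a permutation of $\mathbb{F}_q$, and let $\gamma\in\mathbb{F}_{q^n}$. Then $G(x)=L(x)+\gamma\,h(f(x))$ permutes $\mathbb{F}_{q^n}$ if and only if $b\neq0$ and $\gamma$ does not belong to the image set of $L$.
   Context: A non-zero $\alpha\in\mathbb{F}_{q^n}$ is a $b$-linear translator ($b\in\mathbb{F}_q$) of $f:\mathbb{F}_{q^n}\to\mathbb{F}_q$ if $f(x+u\alpha)-f(x)=ub$ for all $x\in\mathbb{F}_{q^n}$, $u\in\mathbb{F}_q$. -}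

module Defs where

open import Level using (0ℓ)
open import Data.Nat using (ℕ; _^_; _≥_)
open import Data.Nat.Primality using (Prime)
open import Data.Fin using (Fin)
open import Data.Product using (∃; ∃-syntax; _×_)
open import Relation.Nullary using (¬_)
open import Relation.Binary.PropositionalEquality using (_≡_; _≢_)
open import Algebra.Structures using (IsCommutativeRing)
open import Function.Bundles using (_↔_)

IsPrimePower : ℕ → Set
IsPrimePower q = ∃[ p ] ∃[ k ] (Prime p × k ≥ 1 × q ≡ p ^ k)

record Field : Set₁ where
  infixl 6 _+_ _-_
  infixl 7 _*_
  field
    Carrier : Set
    _+_ _*_ : Carrier → Carrier → Carrier
    -_      : Carrier → Carrier
    0# 1#   : Carrier
    isCommutativeRing : IsCommutativeRing _≡_ _+_ _*_ -_ 0# 1#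
    0≢1     : 0# ≢ 1#
    inverse : ∀ x → x ≢ 0# → ∃[ y ] (x * y ≡ 1#)

  _-_ : Carrier → Carrier → Carrier
  x - y = x + (- y)

HasCardinality : Field → ℕ → Set
HasCardinality F m = Field.Carrier F ↔ Fin m

-- A (unital) ring homomorphism K → E; this makes E a field extension of K
record IsFieldHom (K E : Field) (ι : Field.Carrier K → Field.Carrier E) : Set where
  private
    module K = Field K
    module E = Field E
  field
    +-hom : ∀ a b → ι (a K.+ b) ≡ ι a E.+ ι b
    *-hom : ∀ a b → ι (a K.* b) ≡ ι a E.* ι b
    1-hom : ι K.1# ≡ E.1#

record IsLinear (K E : Field) (ι : Field.Carrier K → Field.Carrier E)
                (L : Field.Carrier E → Field.Carrier E) : Set where
  private
    module E = Field E
  field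
    additive : ∀ x y → L (x E.+ y) ≡ L x E.+ L y
    homogeneous : ∀ (c : Field.Carrier K) x → L (ι c E.* x) ≡ ι c E.* L x

IsLinearTranslator : (K E : Field) (ι : Field.Carrier K → Field.Carrier E)
  (f : Field.Carrier E → Field.Carrier K) (α : Field.Carrier E) (b : Field.Carrier K) → Set
IsLinearTranslator K E ι f α b =
  α ≢ Field.0# E ×
  (∀ (x : Field.Carrier E) (u : Field.Carrier K) →
     Field._-_ K (f (Field._+_ E x (Field._*_ E (ι u) α))) (f x) ≡ Field._*_ K u b)

module Submission where

-- Write G_g(x) = L(x) + γ ι(g(x)) for an arbitrary g : E → K.  The argument
-- rests on three algebraic facts about such maps and on finiteness of E.
--   * If γ = L(y), then G_g(x) = L(x + ι(g(x)) y); so G_g onto forces L onto.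
--   * If G_g(x) = G_g(y) with g(x) ≠ g(y), then L((x - y)/(g(y) - g(x))) = γ.
--   * If L(x) = L(y) then x = y + cα; a b-translator then gives
--     f(x) = cb + f(y), so when b ≠ 0 the map f separates each fibre of L.
-- On a finite set an endomap is injective iff it is surjective (pigeonhole).
-- Necessity: b = 0 gives G(α) = G(0); and γ ∈ Im L makes L surjective, hence
-- injective, contradicting L(α) = 0.  Sufficiency: the facts above show that
-- G is injective, hence bijective by finiteness.

open import Defs
open import Level using (0ℓ)
open import Data.Nat using (ℕ; zero; suc; _^_; _≥_)
open import Data.Nat.Properties using (n<1+n)
open import Data.Fin using (Fin; punchOut)
open import Data.Fin.Properties using (pigeonhole; punchOut-injective; any?; _≟_; <⇒≢; inj⇒≟)
open import Data.Product using (∃-syntax; _×_; _,_; proj₁; proj₂)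
open import Data.Empty using (⊥-elim)
open import Relation.Nullary using (¬_; yes; no)
open import Relation.Binary.Definitions using (DecidableEquality)
open import Relation.Binary.PropositionalEquality
open import Function.Base using (_∘_)
open import Function.Definitions using (Injective; StrictlySurjective; Bijective)
open import Function.Bundles using (_⇔_; mk⇔; _↔_; Inverse; Injection; Equivalence)
open import Function.Properties.Inverse using (↔⇒↣; ↔-sym)
open import Function.Consequences.Propositional
  using (strictlySurjective⇒surjective; surjective⇒strictlySurjective)
open import Algebra.Bundles using (AbelianGroup)
open import Algebra.Structures using (IsCommutativeRing)
import Algebra.Properties.AbelianGroup as AbelianGroupProperties

module Finite where

  -- Pigeonhole: an injective g : Fin m → Fin m hits every y.  If y were
  -- missed, g would factor injectively through Fin (m - 1) via punchOut.
  fin-injective⇒surjective : ∀ {m} (g : Fin m → Fin m) →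
    Injective _≡_ _≡_ g → StrictlySurjective _≡_ g
  fin-injective⇒surjective {zero} g g-inj ()
  fin-injective⇒surjective {suc k} g g-inj y with any? (λ x → g x ≟ y)
  ... | yes hit = hit
  ... | no miss =
    let (i , j , i<j , same) = pigeonhole (n<1+n k) (λ i → punchOut (missed i))
    in ⊥-elim (<⇒≢ i<j (g-inj (punchOut-injective (missed i) (missed j) same)))
    where
    missed : ∀ i → y ≢ g i
    missed i y≡gi = miss (i , sym y≡gi)

  module _ {A : Set} {m : ℕ} (A↔Fin : A ↔ Fin m) where
    open Inverse A↔Fin using (to; from)

    to-injective : Injective _≡_ _≡_ to
    to-injective = Injection.injective (↔⇒↣ A↔Fin)

    from-injective : Injective _≡_ _≡_ from
    from-injective = Injection.injective (↔⇒↣ (↔-sym A↔Fin))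

    -- Transport along A ≅ Fin m: F is conjugate to to ∘ F ∘ from.
    injective⇒surjective : (F : A → A) →
      Injective _≡_ _≡_ F → StrictlySurjective _≡_ F
    injective⇒surjective F F-inj y =
      let (i , hit) = fin-injective⇒surjective (to ∘ F ∘ from)
                        (from-injective ∘ F-inj ∘ to-injective) (to y)
      in from i , to-injective hit

    -- A surjective F has a section s (F ∘ s = id); s is injective, hence
    -- surjective, and then F x ≡ F y forces x ≡ y by writing x, y as values of s.
    surjective⇒injective : (F : A → A) →
      StrictlySurjective _≡_ F → Injective _≡_ _≡_ F
    surjective⇒injective F F-surj {x} {y} Fx≡Fy =
      let (a , sa≡x) = s-surj x
          (c , sc≡y) = s-surj y
          a≡c = begin
            a         ≡⟨ sym (section a) ⟩
            F (s a)   ≡⟨ cong F sa≡x ⟩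
            F x       ≡⟨ Fx≡Fy ⟩
            F y       ≡⟨ cong F (sym sc≡y) ⟩
            F (s c)   ≡⟨ section c ⟩
            c         ∎
      in trans (sym sa≡x) (trans (cong s a≡c) sc≡y)
      where
      open ≡-Reasoning
      s : A → A
      s z = proj₁ (F-surj z)
      section : ∀ z → F (s z) ≡ z
      section z = proj₂ (F-surj z)
      s-surj : StrictlySurjective _≡_ s
      s-surj = injective⇒surjective s
        (λ {a} {c} sa≡sc → trans (sym (section a)) (trans (cong F sa≡sc) (section c)))

    decidableEquality : DecidableEquality A
    decidableEquality = inj⇒≟ (↔⇒↣ A↔Fin)

module FieldAlgebra (F : Field) where
  open Field F
  open IsCommutativeRing isCommutativeRing using (+-isAbelianGroup; *-assoc; *-identityʳ; zeroˡ)

  +-abelianGroup : AbelianGroup 0ℓ 0ℓ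
  +-abelianGroup = record
    { Carrier = Carrier ; _≈_ = _≡_ ; _∙_ = _+_ ; ε = 0# ; _⁻¹ = -_
    ; isAbelianGroup = +-isAbelianGroup }

  open AbelianGroupProperties +-abelianGroup public
    using (∙-cancelʳ; identityˡ-unique; identityʳ-unique; inverseʳ-unique;
           x≈y⇒x∙y⁻¹≈ε; x∙y⁻¹≈ε⇒x≈y; xyx⁻¹≈y; //-rightDividesˡ)

  difference⇒sum : ∀ {a c d} → a - c ≡ d → a ≡ d + c
  difference⇒sum {a} {c} a-c≡d = trans (sym (//-rightDividesˡ c a)) (cong (_+ c) a-c≡d)

  no-zero-divisors : ∀ {b c} → c * b ≡ 0# → b ≢ 0# → c ≡ 0#
  no-zero-divisors {b} {c} cb≡0 b≢0 = begin
    c                  ≡⟨ sym (*-identityʳ c) ⟩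
    c * 1#             ≡⟨ cong (c *_) (sym bb⁻¹≡1) ⟩
    c * (b * b⁻¹)      ≡⟨ sym (*-assoc c b b⁻¹) ⟩
    (c * b) * b⁻¹      ≡⟨ cong (_* b⁻¹) cb≡0 ⟩
    0# * b⁻¹           ≡⟨ zeroˡ b⁻¹ ⟩
    0#                 ∎
    where
    open ≡-Reasoning
    b⁻¹ : Carrier
    b⁻¹ = proj₁ (inverse b b≢0)
    bb⁻¹≡1 : b * b⁻¹ ≡ 1#
    bb⁻¹≡1 = proj₂ (inverse b b≢0)

module AdditiveMap (F F′ : Field) (φ : Field.Carrier F → Field.Carrier F′)
  (φ-+ : ∀ x y → φ (Field._+_ F x y) ≡ Field._+_ F′ (φ x) (φ y)) where
  private
    module F = Field F
    module F′ = Field F′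
    module F′A = FieldAlgebra F′

  φ-0 : φ F.0# ≡ F′.0#
  φ-0 = F′A.identityˡ-unique (φ F.0#) (φ F.0#)
          (trans (sym (φ-+ F.0# F.0#))
                 (cong φ (IsCommutativeRing.+-identityˡ F.isCommutativeRing F.0#)))

  φ-neg : ∀ x → φ (F.- x) ≡ F′.- φ x
  φ-neg x = F′A.inverseʳ-unique (φ x) (φ (F.- x))
    (trans (sym (φ-+ x (F.- x)))
      (trans (cong φ (IsCommutativeRing.-‿inverseʳ F.isCommutativeRing x)) φ-0))

  φ-sub : ∀ x y → φ (x F.- y) ≡ φ x F′.- φ y
  φ-sub x y = trans (φ-+ x (F.- y)) (cong (φ x F′.+_) (φ-neg y))

module Perturbation (K E : Field) (ι : Field.Carrier K → Field.Carrier E)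
  (ι-hom : IsFieldHom K E ι) (L : Field.Carrier E → Field.Carrier E)
  (L-lin : IsLinear K E ι L) where
  private
    module K = Field K
    module E = Field E
    module KA = FieldAlgebra K
    module EA = FieldAlgebra E
    module EC = IsCommutativeRing E.isCommutativeRing
  open IsFieldHom ι-hom
  open IsLinear L-lin
  open AdditiveMap K E ι +-hom using () renaming (φ-0 to ι-0)
  open AdditiveMap E E L additive using () renaming (φ-0 to L-0; φ-sub to L-sub)
  open ≡-Reasoning

  perturb : (Field.Carrier E → Field.Carrier K) → E.Carrier → E.Carrier → E.Carrier
  perturb g γ x = L x E.+ γ E.* ι (g x)

  KernelIs : E.Carrier → Set
  KernelIs α = ∀ x → (L x ≡ E.0#) ⇔ (∃[ c ] (x ≡ ι c E.* α))

  kernel-generator : ∀ {α} → KernelIs α → L α ≡ E.0#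
  kernel-generator {α} ker = Equivalence.from (ker α) (K.1# , sym ι1α≡α)
    where
    ι1α≡α : ι K.1# E.* α ≡ α
    ι1α≡α = trans (cong (E._* α) 1-hom) (EC.*-identityˡ α)

  same-fibre : ∀ {α x y} → KernelIs α → L x ≡ L y → ∃[ c ] (x ≡ ι c E.* α E.+ y)
  same-fibre {α} {x} {y} ker Lx≡Ly =
    let (c , x-y≡cα) = Equivalence.to (ker (x E.- y))
                         (trans (L-sub x y) (EA.x≈y⇒x∙y⁻¹≈ε Lx≡Ly))
    in c , EA.difference⇒sum x-y≡cα

  nontrivial-kernel : ∀ {α} → L α ≡ E.0# → α ≢ E.0# → ¬ Injective _≡_ _≡_ L
  nontrivial-kernel Lα≡0 α≢0 L-inj = α≢0 (L-inj (trans Lα≡0 (sym L-0)))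

  translator-shift : ∀ {f α b} → IsLinearTranslator K E ι f α b →
    ∀ x u → f (x E.+ ι u E.* α) ≡ u K.* b K.+ f x
  translator-shift (_ , shift) x u = KA.difference⇒sum (shift x u)

  translator-separates-fibres : ∀ {f α b x y} → KernelIs α →
    IsLinearTranslator K E ι f α b → b ≢ K.0# →
    L x ≡ L y → f x ≡ f y → x ≡ y
  translator-separates-fibres {f} {α} {b} {x} {y} ker translator b≢0 Lx≡Ly fx≡fy =
    begin
      x                       ≡⟨ x≡cα+y ⟩
      ι c E.* α E.+ y         ≡⟨ cong (λ t → ι t E.* α E.+ y) c≡0 ⟩
      ι K.0# E.* α E.+ y      ≡⟨ cong (λ t → t E.* α E.+ y) ι-0 ⟩
      E.0# E.* α E.+ y        ≡⟨ cong (E._+ y) (EC.zeroˡ α) ⟩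
      E.0# E.+ y              ≡⟨ EC.+-identityˡ y ⟩
      y                       ∎
    where
    c : K.Carrier
    c = proj₁ (same-fibre ker Lx≡Ly)
    x≡cα+y : x ≡ ι c E.* α E.+ y
    x≡cα+y = proj₂ (same-fibre ker Lx≡Ly)
    -- f(y) + cb = f(x) = f(y), so cb = 0 and hence c = 0.
    cb+fy≡fy : c K.* b K.+ f y ≡ f y
    cb+fy≡fy = trans (sym (translator-shift translator y c))
                 (trans (cong f (trans (EC.+-comm y _) (sym x≡cα+y))) fx≡fy)
    c≡0 : c ≡ K.0#
    c≡0 = KA.no-zero-divisors (KA.identityˡ-unique (c K.* b) (f y) cb+fy≡fy) b≢0

  -- With b = 0 the function f, hence G, is constant along α.
  zero-translator⇒not-injective : ∀ {f α} (h : K.Carrier → K.Carrier) γ →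
    L α ≡ E.0# → α ≢ E.0# → IsLinearTranslator K E ι f α K.0# →
    ¬ Injective _≡_ _≡_ (perturb (h ∘ f) γ)
  zero-translator⇒not-injective {f} {α} h γ Lα≡0 α≢0 translator G-inj =
    α≢0 (trans (sym ι1α≡α) (EA.identityʳ-unique E.0# _ (G-inj G-shift≡G0)))
    where
    α′ : E.Carrier
    α′ = ι K.1# E.* α
    ι1α≡α : α′ ≡ α
    ι1α≡α = trans (cong (E._* α) 1-hom) (EC.*-identityˡ α)
    L-shift : L (E.0# E.+ α′) ≡ L E.0#
    L-shift = begin
      L (E.0# E.+ α′)           ≡⟨ additive E.0# α′ ⟩
      L E.0# E.+ L α′           ≡⟨ cong (L E.0# E.+_) (homogeneous K.1# α) ⟩
      L E.0# E.+ ι K.1# E.* L α ≡⟨ cong (λ t → L E.0# E.+ ι K.1# E.* t) Lα≡0 ⟩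
      L E.0# E.+ ι K.1# E.* E.0# ≡⟨ cong (L E.0# E.+_) (EC.zeroʳ _) ⟩
      L E.0# E.+ E.0#           ≡⟨ EC.+-identityʳ _ ⟩
      L E.0#                    ∎
    f-shift : f (E.0# E.+ α′) ≡ f E.0#
    f-shift = trans (translator-shift translator E.0# K.1#)
      (trans (cong (K._+ f E.0#) (IsCommutativeRing.zeroʳ K.isCommutativeRing K.1#))
             (IsCommutativeRing.+-identityˡ K.isCommutativeRing (f E.0#)))
    G-shift≡G0 : perturb (h ∘ f) γ (E.0# E.+ α′) ≡ perturb (h ∘ f) γ E.0#
    G-shift≡G0 = cong₂ E._+_ L-shift (cong (λ t → γ E.* ι (h t)) f-shift)

  image⇒factorisation : ∀ {y γ} (g : E.Carrier → K.Carrier) → L y ≡ γ →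
    ∀ x → L (x E.+ ι (g x) E.* y) ≡ perturb g γ x
  image⇒factorisation {y} {γ} g Ly≡γ x = begin
    L (x E.+ ι (g x) E.* y)     ≡⟨ additive x _ ⟩
    L x E.+ L (ι (g x) E.* y)   ≡⟨ cong (L x E.+_) (homogeneous (g x) y) ⟩
    L x E.+ ι (g x) E.* L y     ≡⟨ cong (λ t → L x E.+ ι (g x) E.* t) Ly≡γ ⟩
    L x E.+ ι (g x) E.* γ       ≡⟨ cong (L x E.+_) (EC.*-comm (ι (g x)) γ) ⟩
    L x E.+ γ E.* ι (g x)       ∎

  image⇒L-surjective : ∀ {y γ} (g : E.Carrier → K.Carrier) → L y ≡ γ →
    StrictlySurjective _≡_ (perturb g γ) → StrictlySurjective _≡_ L
  image⇒L-surjective {y} g Ly≡γ G-surj z =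
    let (x , Gx≡z) = G-surj z
    in x E.+ ι (g x) E.* y , trans (image⇒factorisation g Ly≡γ x) Gx≡z

  same-level⇒same-image : ∀ {g γ x y} → perturb g γ x ≡ perturb g γ y →
    g x ≡ g y → L x ≡ L y
  same-level⇒same-image {g} {γ} {x} {y} Gx≡Gy gx≡gy =
    EA.∙-cancelʳ (γ E.* ι (g y)) (L x) (L y)
      (trans (cong (λ t → L x E.+ γ E.* ι t) (sym gx≡gy)) Gx≡Gy)

  -- A collision of G_g across different levels exhibits γ in the image of L:
  -- with c = g(y) - g(x) ≠ 0 one gets L(x - y) = γ ι(c), so L(ι(c⁻¹)(x - y)) = γ.
  different-level⇒image : ∀ {g γ x y} → perturb g γ x ≡ perturb g γ y →
    g x ≢ g y → ∃[ z ] (L z ≡ γ)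
  different-level⇒image {g} {γ} {x} {y} Gx≡Gy gx≢gy =
    ι d E.* (x E.- y) , (begin
      L (ι d E.* (x E.- y))   ≡⟨ homogeneous d _ ⟩
      ι d E.* L (x E.- y)     ≡⟨ cong (ι d E.*_) L[x-y]≡γιc ⟩
      ι d E.* (γ E.* ι c)     ≡⟨ sym (EC.*-assoc _ γ _) ⟩
      (ι d E.* γ) E.* ι c     ≡⟨ cong (E._* ι c) (EC.*-comm (ι d) γ) ⟩
      (γ E.* ι d) E.* ι c     ≡⟨ EC.*-assoc γ _ _ ⟩
      γ E.* (ι d E.* ι c)     ≡⟨ cong (γ E.*_) (sym (*-hom d c)) ⟩
      γ E.* ι (d K.* c)       ≡⟨ cong (λ t → γ E.* ι t) dc≡1 ⟩
      γ E.* ι K.1#            ≡⟨ cong (γ E.*_) 1-hom ⟩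
      γ E.* E.1#              ≡⟨ EC.*-identityʳ γ ⟩
      γ                       ∎)
    where
    c : K.Carrier
    c = g y K.- g x
    c≢0 : c ≢ K.0#
    c≢0 c≡0 = gx≢gy (sym (KA.x∙y⁻¹≈ε⇒x≈y (g y) (g x) c≡0))
    d : K.Carrier
    d = proj₁ (K.inverse c c≢0)
    dc≡1 : d K.* c ≡ K.1#
    dc≡1 = trans (IsCommutativeRing.*-comm K.isCommutativeRing d c) (proj₂ (K.inverse c c≢0))
    -- γ ι(g y) = γ ι(c) + γ ι(g x); cancel γ ι(g x) from the collision.
    Lx≡Ly+γιc : L x ≡ L y E.+ γ E.* ι c
    Lx≡Ly+γιc = EA.∙-cancelʳ (γ E.* ι (g x)) (L x) _ (begin
      L x E.+ γ E.* ι (g x)                     ≡⟨ Gx≡Gy ⟩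
      L y E.+ γ E.* ι (g y)                     ≡⟨ cong (λ t → L y E.+ γ E.* ι t) (KA.difference⇒sum refl) ⟩
      L y E.+ γ E.* ι (c K.+ g x)               ≡⟨ cong (λ t → L y E.+ γ E.* t) (+-hom c (g x)) ⟩
      L y E.+ γ E.* (ι c E.+ ι (g x))           ≡⟨ cong (L y E.+_) (EC.distribˡ γ (ι c) (ι (g x))) ⟩
      L y E.+ (γ E.* ι c E.+ γ E.* ι (g x))     ≡⟨ sym (EC.+-assoc _ _ _) ⟩
      L y E.+ γ E.* ι c E.+ γ E.* ι (g x)       ∎)
    L[x-y]≡γιc : L (x E.- y) ≡ γ E.* ι c
    L[x-y]≡γιc = trans (L-sub x y)
      (trans (cong (E._- L y) Lx≡Ly+γιc) (EA.xyx⁻¹≈y (L y) (γ E.* ι c)))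

  perturbation-injective : ∀ {α f b} (h : K.Carrier → K.Carrier) γ →
    DecidableEquality K.Carrier → KernelIs α → IsLinearTranslator K E ι f α b →
    b ≢ K.0# → ¬ (∃[ y ] (L y ≡ γ)) → Injective _≡_ _≡_ h →
    Injective _≡_ _≡_ (perturb (h ∘ f) γ)
  perturbation-injective {f = f} h γ _≟K_ ker translator b≢0 γ∉ImL h-inj {x} {y} Gx≡Gy
    with h (f x) ≟K h (f y)
  ... | yes same-level = translator-separates-fibres ker translator b≢0
          (same-level⇒same-image Gx≡Gy same-level) (h-inj same-level)
  ... | no different-level = ⊥-elim (γ∉ImL (different-level⇒image Gx≡Gy different-level))

mainTheorem17 : (q n : ℕ) → IsPrimePower q → n ≥ 1 →
    (K E : Field) → HasCardinality K q → HasCardinality E (q ^ n) →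
    (ι : Field.Carrier K → Field.Carrier E) → IsFieldHom K E ι →
    (L : Field.Carrier E → Field.Carrier E) → IsLinear K E ι L →
    (α : Field.Carrier E) → α ≢ Field.0# E →
    (∀ x → (L x ≡ Field.0# E) ⇔ (∃[ c ] (x ≡ Field._*_ E (ι c) α))) →
    (f : Field.Carrier E → Field.Carrier K) → (b : Field.Carrier K) →
    IsLinearTranslator K E ι f α b →
    (h : Field.Carrier K → Field.Carrier K) → Bijective _≡_ _≡_ h →
    (γ : Field.Carrier E) →
    Bijective _≡_ _≡_ (λ x → Field._+_ E (L x) (Field._*_ E γ (ι (h (f x)))))
    ⇔ ((b ≢ Field.0# K) × (¬ (∃[ y ] (L y ≡ γ))))
mainTheorem17 _ _ _ _ K E K↔Fin E↔Fin ι ι-hom L L-lin α α≢0 ker f b translator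
  h (h-inj , _) γ = mk⇔ necessary sufficient
  where
  open Perturbation K E ι ι-hom L L-lin
  open Finite

  necessary : Bijective _≡_ _≡_ (perturb (h ∘ f) γ) →
    (b ≢ Field.0# K) × (¬ (∃[ y ] (L y ≡ γ)))
  necessary (G-inj , G-surj) = b≢0 , γ∉ImL
    where
    b≢0 : b ≢ Field.0# K
    b≢0 b≡0 = zero-translator⇒not-injective h γ (kernel-generator ker) α≢0
      (subst (IsLinearTranslator K E ι f α) b≡0 translator) G-inj
    -- γ = L(y) would make L surjective, hence injective on the finite E.
    γ∉ImL : ¬ (∃[ y ] (L y ≡ γ))
    γ∉ImL (y , Ly≡γ) = nontrivial-kernel (kernel-generator ker) α≢0
      (surjective⇒injective E↔Fin L
        (image⇒L-surjective (h ∘ f) Ly≡γ (surjective⇒strictlySurjective G-surj)))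

  sufficient : (b ≢ Field.0# K) × (¬ (∃[ y ] (L y ≡ γ))) →
    Bijective _≡_ _≡_ (perturb (h ∘ f) γ)
  sufficient (b≢0 , γ∉ImL) =
    G-inj , strictlySurjective⇒surjective (injective⇒surjective E↔Fin _ G-inj)
    where
    G-inj : Injective _≡_ _≡_ (perturb (h ∘ f) γ)
    G-inj = perturbation-injective h γ (decidableEquality K↔Fin) ker translator
              b≢0 γ∉ImL h-inj
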